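{- For every closed term $t$, neither the code of the sentence $Pt$ nor the code of the sentence $\neg Pt$ belongs to $P_\infty^+$, the extension of the paradoxicality predicate in the least fixed point $(T_\infty,P_\infty)$ of $\Gamma_{\mathscr{TP}}$.
   Context: $\mathcal L=\mathcal L_{\mathbb N}\cup\{T,P\}$, Tait style (literals $s=t,s\neq t,Tt,\neg Tt,Pt,\neg Pt$; $\wedge,\vee,\forall,\exists$; negation by De Morgan with $\neg\neg\varphi:=\varphi$), fixed Gödel numbering. Interpretations $(T,P)$ with $T=(T^+,T^-)$, $P=(P^+,P^-)\subseteq\omega$; $\models_{SK}$ is Strong Kleene satisfaction in $(\mathbb N,T,P)$ ($Tt$ iff $\mathrm{val}(t)\in T^+$, $\neg Tt$ iff $\mathrm{val}(t)\in T^-$, likewise $P$). $\mathrm{PA}[\mathrm{SK}]$ is Peano arithmetic over the Strong Kleene sequent calculus with identity (no right negation rule), induction for all $\mathcal L$-formulas. $B(x)$ is an arithmetical formula representing the set of sentences $\varphi$ with $\mathrm{PA}[\mathrm{SK}]\vdash\varphi\Leftrightarrow\neg T\varphi$ and $\mathrm{PA}[\mathrm{SK}]\vdash\neg\varphi\Leftrightarrow T\varphi$; $\Pi(x):=B(x)\vee B(\neg x)$. $\mathscr P(x)$: $x$ is a sentence and one of: $\Pi(x)$; $x=Ts$ and $P\,\mathrm{val}(s)$; $x=\neg Ts$ and $P\,\mathrm{val}(s)$; $x=\psi\wedge\theta$ and $(P\psi\wedge P\theta)\vee(T\psi\wedge P\theta)\vee(T\theta\wedge P\psi)$; $x=\psi\vee\theta$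 and $(P\psi\wedge P\theta)\vee(\neg T\psi\wedge P\theta)\vee(\neg T\theta\wedge P\psi)$; $x=\forall v\psi$ and $\exists yP\psi(\dot y)\wedge\forall y(P\psi(\dot y)\vee T\psi(\dot y))$; $x=\exists v\psi$ and $\exists yP\psi(\dot y)\wedge\forall y(P\psi(\dot y)\vee\neg T\psi(\dot y))$. $\Gamma_{\mathscr{TP}}(T,P)=\big((\{\#\varphi:\models_{SK}\varphi\},\{\#\varphi:\models_{SK}\neg\varphi\}),(\{\#\varphi:\models_{SK}\mathscr P(\ulcorner\varphi\urcorner)\},\{\#\varphi:\models_{SK}\varphi\vee\neg\varphi\})\big)$, satisfaction in $(\mathbb N,T,P)$. The sequence starting from all-empty sets, iterating $\Gamma_{\mathscr{TP}}$ at successors and taking unions at limits, reaches the least fixed point $(T_\infty,P_\infty)$. -}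

module Defs where

open import Data.Nat using (ℕ; zero; suc; _+_; _*_; _^_)
open import Data.Fin using (Fin; toℕ) renaming (zero to fz; suc to fs)
open import Data.List using (List; []; _∷_; map)
open import Data.List.Relation.Binary.Subset.Propositional using (_⊆_)
open import Data.Product using (Σ; _×_)
open import Data.Sum using (_⊎_)
open import Data.Empty using (⊥)
open import Relation.Binary.PropositionalEquality using (_≡_; _≢_)

-- Syntax of L = L_ℕ ∪ {T, P}, Tait style, well-scoped de Bruijn.
-- Term n / Formula n : at most n free variables; sentences are Formula 0.

infixl 10 _⊕_
infixl 11 _⊗_
infix  9 _≐_ _≉_
infixr 8 _∧_
infixr 7 _∨_

data Term (n : ℕ) : Set where
  var : Fin n → Term n
  `0  : Term n
  S   : Term n → Term n
  _⊕_ : Term n → Term n → Term n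
  _⊗_ : Term n → Term n → Term n

data Formula (n : ℕ) : Set where
  _≐_  : Term n → Term n → Formula n
  _≉_  : Term n → Term n → Formula n
  Tr   : Term n → Formula n
  ¬Tr  : Term n → Formula n
  Pd   : Term n → Formula n
  ¬Pd  : Term n → Formula n
  _∧_  : Formula n → Formula n → Formula n
  _∨_  : Formula n → Formula n → Formula n
  ∀'   : Formula (suc n) → Formula n
  ∃'   : Formula (suc n) → Formula n

Sentence : Set
Sentence = Formula 0

neg : ∀ {n} → Formula n → Formula n
neg (s ≐ t) = s ≉ t
neg (s ≉ t) = s ≐ t
neg (Tr t)  = ¬Tr t
neg (¬Tr t) = Tr t
neg (Pd t)  = ¬Pd t
neg (¬Pd t) = Pd t
neg (φ ∧ ψ) = neg φ ∨ neg ψ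
neg (φ ∨ ψ) = neg φ ∧ neg ψ
neg (∀' φ)  = ∃' (neg φ)
neg (∃' φ)  = ∀' (neg φ)

trename : ∀ {m n} → (Fin m → Fin n) → Term m → Term n
trename ρ (var i) = var (ρ i)
trename ρ `0      = `0
trename ρ (S t)   = S (trename ρ t)
trename ρ (s ⊕ t) = trename ρ s ⊕ trename ρ t
trename ρ (s ⊗ t) = trename ρ s ⊗ trename ρ t

liftR : ∀ {m n} → (Fin m → Fin n) → Fin (suc m) → Fin (suc n)
liftR ρ fz     = fz
liftR ρ (fs i) = fs (ρ i)

frename : ∀ {m n} → (Fin m → Fin n) → Formula m → Formula n
frename ρ (s ≐ t) = trename ρ s ≐ trename ρ t
frename ρ (s ≉ t) = trename ρ s ≉ trename ρ t
frename ρ (Tr t)  = Tr (trename ρ t)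
frename ρ (¬Tr t) = ¬Tr (trename ρ t)
frename ρ (Pd t)  = Pd (trename ρ t)
frename ρ (¬Pd t) = ¬Pd (trename ρ t)
frename ρ (φ ∧ ψ) = frename ρ φ ∧ frename ρ ψ
frename ρ (φ ∨ ψ) = frename ρ φ ∨ frename ρ ψ
frename ρ (∀' φ)  = ∀' (frename (liftR ρ) φ)
frename ρ (∃' φ)  = ∃' (frename (liftR ρ) φ)

wk : ∀ {n} → Formula n → Formula (suc n)
wk = frename fs

tsubst : ∀ {m n} → (Fin m → Term n) → Term m → Term n
tsubst σ (var i) = σ i
tsubst σ `0      = `0
tsubst σ (S t)   = S (tsubst σ t)
tsubst σ (s ⊕ t) = tsubst σ s ⊕ tsubst σ t
tsubst σ (s ⊗ t) = tsubst σ s ⊗ tsubst σ t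

liftS : ∀ {m n} → (Fin m → Term n) → Fin (suc m) → Term (suc n)
liftS σ fz     = var fz
liftS σ (fs i) = trename fs (σ i)

fsubst : ∀ {m n} → (Fin m → Term n) → Formula m → Formula n
fsubst σ (s ≐ t) = tsubst σ s ≐ tsubst σ t
fsubst σ (s ≉ t) = tsubst σ s ≉ tsubst σ t
fsubst σ (Tr t)  = Tr (tsubst σ t)
fsubst σ (¬Tr t) = ¬Tr (tsubst σ t)
fsubst σ (Pd t)  = Pd (tsubst σ t)
fsubst σ (¬Pd t) = ¬Pd (tsubst σ t)
fsubst σ (φ ∧ ψ) = fsubst σ φ ∧ fsubst σ ψ
fsubst σ (φ ∨ ψ) = fsubst σ φ ∨ fsubst σ ψ
fsubst σ (∀' φ)  = ∀' (fsubst (liftS σ) φ)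
fsubst σ (∃' φ)  = ∃' (fsubst (liftS σ) φ)

inst : ∀ {n} → Term n → Fin (suc n) → Term n
inst t fz     = t
inst t (fs i) = var i

_[_] : ∀ {n} → Formula (suc n) → Term n → Formula n
φ [ t ] = fsubst (inst t) φ

succVar : ∀ {n} → Fin (suc n) → Term (suc n)
succVar fz     = S (var fz)
succVar (fs i) = var (fs i)

_[S0] : ∀ {n} → Formula (suc n) → Formula (suc n)
φ [S0] = fsubst succVar φ

num : ∀ {n} → ℕ → Term n
num zero    = `0
num (suc k) = S (num k)

pair : ℕ → ℕ → ℕ
pair a b = 2 ^ a * suc (2 * b)

tcode : ∀ {n} → Term n → ℕ
tcode (var i) = pair 0 (toℕ i)
tcode `0      = pair 1 0
tcode (S t)   = pair 2 (tcode t)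
tcode (s ⊕ t) = pair 3 (pair (tcode s) (tcode t))
tcode (s ⊗ t) = pair 4 (pair (tcode s) (tcode t))

#_ : ∀ {n} → Formula n → ℕ
# (s ≐ t) = pair 0 (pair (tcode s) (tcode t))
# (s ≉ t) = pair 1 (pair (tcode s) (tcode t))
# (Tr t)  = pair 2 (tcode t)
# (¬Tr t) = pair 3 (tcode t)
# (Pd t)  = pair 4 (tcode t)
# (¬Pd t) = pair 5 (tcode t)
# (φ ∧ ψ) = pair 6 (pair (# φ) (# ψ))
# (φ ∨ ψ) = pair 7 (pair (# φ) (# ψ))
# (∀' φ)  = pair 8 (# φ)
# (∃' φ)  = pair 9 (# φ)

⌜_⌝ : ∀ {n} → Formula n → Term 0
⌜ φ ⌝ = num (# φ)

-- PA[SK]: Peano arithmetic over the Strong Kleene sequent calculus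
-- with identity (no right negation rule), induction for all L-formulas.

infix 1 _⇒_

data _⇒_ {n : ℕ} : List (Formula n) → List (Formula n) → Set where
  ax     : ∀ φ → (φ ∷ []) ⇒ (φ ∷ [])
  axK3   : ∀ φ → (φ ∷ neg φ ∷ []) ⇒ []
  -- structural rules (weakening, contraction, exchange)
  struct : ∀ {Γ Γ' Δ Δ'} → Γ ⊆ Γ' → Δ ⊆ Δ' → Γ ⇒ Δ → Γ' ⇒ Δ'
  cut    : ∀ {Γ Δ} φ → Γ ⇒ (φ ∷ Δ) → (φ ∷ Γ) ⇒ Δ → Γ ⇒ Δ
  ∧L     : ∀ {Γ Δ φ ψ} → (φ ∷ ψ ∷ Γ) ⇒ Δ → (φ ∧ ψ ∷ Γ) ⇒ Δ
  ∧R     : ∀ {Γ Δ φ ψ} → Γ ⇒ (φ ∷ Δ) → Γ ⇒ (ψ ∷ Δ) → Γ ⇒ (φ ∧ ψ ∷ Δ)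
  ∨L     : ∀ {Γ Δ φ ψ} → (φ ∷ Γ) ⇒ Δ → (ψ ∷ Γ) ⇒ Δ → (φ ∨ ψ ∷ Γ) ⇒ Δ
  ∨R     : ∀ {Γ Δ φ ψ} → Γ ⇒ (φ ∷ ψ ∷ Δ) → Γ ⇒ (φ ∨ ψ ∷ Δ)
  ∀L     : ∀ {Γ Δ} {φ : Formula (suc n)} (t : Term n) →
           (φ [ t ] ∷ Γ) ⇒ Δ → (∀' φ ∷ Γ) ⇒ Δ
  ∀R     : ∀ {Γ Δ} {φ : Formula (suc n)} →
           map wk Γ ⇒ (φ ∷ map wk Δ) → Γ ⇒ (∀' φ ∷ Δ)
  ∃L     : ∀ {Γ Δ} {φ : Formula (suc n)} →
           (φ ∷ map wk Γ) ⇒ map wk Δ → (∃' φ ∷ Γ) ⇒ Δ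
  ∃R     : ∀ {Γ Δ} {φ : Formula (suc n)} (t : Term n) →
           Γ ⇒ (φ [ t ] ∷ Δ) → Γ ⇒ (∃' φ ∷ Δ)
  eqRefl : ∀ (t : Term n) → [] ⇒ (t ≐ t ∷ [])
  eqSubst : ∀ (s t : Term n) (φ : Formula (suc n)) →
            (s ≐ t ∷ φ [ s ] ∷ []) ⇒ (φ [ t ] ∷ [])
  eqDec  : ∀ (s t : Term n) → [] ⇒ (s ≐ t ∷ s ≉ t ∷ [])
  paSucc0 : ∀ (s : Term n) → [] ⇒ (S s ≉ `0 ∷ [])
  paSuccInj : ∀ (s t : Term n) → (S s ≐ S t ∷ []) ⇒ (s ≐ t ∷ [])
  paAdd0 : ∀ (s : Term n) → [] ⇒ (s ⊕ `0 ≐ s ∷ [])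
  paAddS : ∀ (s t : Term n) → [] ⇒ (s ⊕ S t ≐ S (s ⊕ t) ∷ [])
  paMul0 : ∀ (s : Term n) → [] ⇒ (s ⊗ `0 ≐ `0 ∷ [])
  paMulS : ∀ (s t : Term n) → [] ⇒ (s ⊗ S t ≐ s ⊗ t ⊕ s ∷ [])
  ind    : ∀ {Γ Δ} (φ : Formula (suc n)) (t : Term n) →
           (φ ∷ map wk Γ) ⇒ (φ [S0] ∷ map wk Δ) →
           (φ [ `0 ] ∷ Γ) ⇒ (φ [ t ] ∷ Δ)

_⇔ₚ_ : Sentence → Sentence → Set
φ ⇔ₚ ψ = ((φ ∷ []) ⇒ (ψ ∷ [])) × ((ψ ∷ []) ⇒ (φ ∷ []))

InB : Sentence → Set
InB φ = (φ ⇔ₚ ¬Tr ⌜ φ ⌝) × (neg φ ⇔ₚ Tr ⌜ φ ⌝)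

InΠ : Sentence → Set
InΠ φ = InB φ ⊎ InB (neg φ)

record Interp : Set₁ where
  field
    T⁺ T⁻ P⁺ P⁻ : ℕ → Set
open Interp public

⟦_⟧ : ∀ {n} → Term n → (Fin n → ℕ) → ℕ
⟦ var i ⟧ ρ = ρ i
⟦ `0 ⟧    ρ = 0
⟦ S t ⟧   ρ = suc (⟦ t ⟧ ρ)
⟦ s ⊕ t ⟧ ρ = ⟦ s ⟧ ρ + ⟦ t ⟧ ρ
⟦ s ⊗ t ⟧ ρ = ⟦ s ⟧ ρ * ⟦ t ⟧ ρ

ext : ∀ {n} → ℕ → (Fin n → ℕ) → Fin (suc n) → ℕ
ext m ρ fz     = m
ext m ρ (fs i) = ρ i

SatE : ∀ {n} → Interp → (Fin n → ℕ) → Formula n → Set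
SatE I ρ (s ≐ t) = ⟦ s ⟧ ρ ≡ ⟦ t ⟧ ρ
SatE I ρ (s ≉ t) = ⟦ s ⟧ ρ ≢ ⟦ t ⟧ ρ
SatE I ρ (Tr t)  = T⁺ I (⟦ t ⟧ ρ)
SatE I ρ (¬Tr t) = T⁻ I (⟦ t ⟧ ρ)
SatE I ρ (Pd t)  = P⁺ I (⟦ t ⟧ ρ)
SatE I ρ (¬Pd t) = P⁻ I (⟦ t ⟧ ρ)
SatE I ρ (φ ∧ ψ) = SatE I ρ φ × SatE I ρ ψ
SatE I ρ (φ ∨ ψ) = SatE I ρ φ ⊎ SatE I ρ ψ
SatE I ρ (∀' φ)  = (m : ℕ) → SatE I (ext m ρ) φ
SatE I ρ (∃' φ)  = Σ ℕ λ m → SatE I (ext m ρ) φ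

noVars : Fin 0 → ℕ
noVars ()

_⊨_ : Interp → Sentence → Set
I ⊨ φ = SatE I noVars φ

val : Term 0 → ℕ
val t = ⟦ t ⟧ noVars

-- The arithmetical subformulas (Π(x), "x = Ts", "x = ψ ∧ θ", ...) are
-- evaluated by their intended meaning; the T/P-literals Strong-Kleene-wise.

𝒫shape : Interp → Sentence → Set
𝒫shape I (Tr s)  = P⁺ I (val s)
𝒫shape I (¬Tr s) = P⁺ I (val s)
𝒫shape I (ψ ∧ θ) = (P⁺ I (# ψ) × P⁺ I (# θ)) ⊎ (T⁺ I (# ψ) × P⁺ I (# θ))
                   ⊎ (T⁺ I (# θ) × P⁺ I (# ψ))
𝒫shape I (ψ ∨ θ) = (P⁺ I (# ψ) × P⁺ I (# θ)) ⊎ (T⁻ I (# ψ) × P⁺ I (# θ))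
                   ⊎ (T⁻ I (# θ) × P⁺ I (# ψ))
𝒫shape I (∀' ψ)  = (Σ ℕ λ y → P⁺ I (# (ψ [ num y ])))
                   × ((y : ℕ) → P⁺ I (# (ψ [ num y ])) ⊎ T⁺ I (# (ψ [ num y ])))
𝒫shape I (∃' ψ)  = (Σ ℕ λ y → P⁺ I (# (ψ [ num y ])))
                   × ((y : ℕ) → P⁺ I (# (ψ [ num y ])) ⊎ T⁻ I (# (ψ [ num y ])))
𝒫shape I _       = ⊥

𝒫sat : Interp → Sentence → Set
𝒫sat I φ = InΠ φ ⊎ 𝒫shape I φ

CodeOf : (Sentence → Set) → ℕ → Set
CodeOf Q n = Σ Sentence λ φ → (# φ ≡ n) × Q φ

Γ𝒯𝒫 : Interp → Interp
T⁺ (Γ𝒯𝒫 I) = CodeOf (λ φ → I ⊨ φ)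
T⁻ (Γ𝒯𝒫 I) = CodeOf (λ φ → I ⊨ neg φ)
P⁺ (Γ𝒯𝒫 I) = CodeOf (λ φ → 𝒫sat I φ)
P⁻ (Γ𝒯𝒫 I) = CodeOf (λ φ → I ⊨ (φ ∨ neg φ))

Closed : Interp → Set
Closed I = ((n : ℕ) → T⁺ (Γ𝒯𝒫 I) n → T⁺ I n)
         × ((n : ℕ) → T⁻ (Γ𝒯𝒫 I) n → T⁻ I n)
         × ((n : ℕ) → P⁺ (Γ𝒯𝒫 I) n → P⁺ I n)
         × ((n : ℕ) → P⁻ (Γ𝒯𝒫 I) n → P⁻ I n)

-- Membership in P∞⁺ for the least fixed point (T∞,P∞) of the monotone
-- operator Γ_TP: the intersection of all Γ-closed interpretations.
P∞⁺ : ℕ → Set₁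
P∞⁺ n = (I : Interp) → Closed I → P⁺ I n

{-# OPTIONS --safe #-}
-- A P-literal can satisfy 𝒫 only through Π, i.e. only if PA[SK] proves
-- Pt ⇔ ¬T⌜Pt⌝ or ¬Pt ⇔ ¬T⌜¬Pt⌝.  PA[SK] is sound for the negative
-- (Gödel–Gentzen) reading of every interpretation whose predicates are
-- ¬¬-stable and consistent, and in the interpretation where T has empty
-- extension and anti-extension while P (resp. ¬P) holds everywhere, the
-- left side of such an equivalence holds and the right side fails.  Hence the
-- interpretation whose T⁺, T⁻, P⁻ are everything and whose P⁺ is everything
-- except the codes of P-literals is Γ𝒯𝒫-closed, so P∞⁺ misses those codes.
module Submission where

open import Defs
open import Data.Product using (_×_)
open import Relation.Nullary using (¬_)

open import Data.Bool using (Bool; true; false)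
open import Data.Bool.Properties using () renaming (_≟_ to _≟ᵇ_)
open import Data.Empty using (⊥; ⊥-elim)
open import Data.Fin using (Fin) renaming (zero to fz; suc to fs)
open import Data.List using (List; []; _∷_; map)
open import Data.List.Relation.Unary.All using (All; []; _∷_) renaming (map to All-map)
open import Data.List.Relation.Unary.All.Properties using (map⁺; anti-mono)
open import Data.Nat using (ℕ; zero; suc; _+_; _*_; _^_)
open import Data.Nat.Properties
open import Data.Product using (Σ; _,_)
open import Data.Product.Function.NonDependent.Propositional using (_×-⇔_)
open import Data.Sum using (_⊎_; inj₁; inj₂; [_,_])
open import Data.Unit using (⊤; tt)
open import Function using (_∘_; id; _⇔_; mk⇔; Equivalence)
open import Function.Related.Propositional using (≡⇒)
open import Function.Related.TypeIsomorphisms using (¬-cong-⇔)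
open import Relation.Binary.PropositionalEquality using (_≡_; _≢_; refl; sym; trans; cong; cong₂; subst)
open import Relation.Nullary.Decidable using (decidable-stable)
open import Relation.Nullary.Negation using (Stable)

open Equivalence using (to; from)

≡⇒⇔ : {A B : Set} → A ≡ B → A ⇔ B
≡⇒⇔ = ≡⇒

∀-cong-⇔ : {A B : ℕ → Set} → (∀ m → A m ⇔ B m) → (∀ m → A m) ⇔ (∀ m → B m)
∀-cong-⇔ A⇔B = mk⇔ (λ f m → to (A⇔B m) (f m)) (λ f m → from (A⇔B m) (f m))

⟦⟧-rename : ∀ {m n} (r : Fin m → Fin n) {ρ : Fin n → ℕ} {ρ' : Fin m → ℕ} →
            (∀ i → ρ (r i) ≡ ρ' i) → ∀ t → ⟦ trename r t ⟧ ρ ≡ ⟦ t ⟧ ρ'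
⟦⟧-rename r h (var i) = h i
⟦⟧-rename r h `0      = refl
⟦⟧-rename r h (S t)   = cong suc (⟦⟧-rename r h t)
⟦⟧-rename r h (s ⊕ t) = cong₂ _+_ (⟦⟧-rename r h s) (⟦⟧-rename r h t)
⟦⟧-rename r h (s ⊗ t) = cong₂ _*_ (⟦⟧-rename r h s) (⟦⟧-rename r h t)

⟦⟧-subst : ∀ {m n} (σ : Fin m → Term n) {ρ : Fin n → ℕ} {ρ' : Fin m → ℕ} →
           (∀ i → ⟦ σ i ⟧ ρ ≡ ρ' i) → ∀ t → ⟦ tsubst σ t ⟧ ρ ≡ ⟦ t ⟧ ρ'
⟦⟧-subst σ h (var i) = h i
⟦⟧-subst σ h `0      = refl
⟦⟧-subst σ h (S t)   = cong suc (⟦⟧-subst σ h t)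
⟦⟧-subst σ h (s ⊕ t) = cong₂ _+_ (⟦⟧-subst σ h s) (⟦⟧-subst σ h t)
⟦⟧-subst σ h (s ⊗ t) = cong₂ _*_ (⟦⟧-subst σ h s) (⟦⟧-subst σ h t)

ext-liftR : ∀ {m n} {r : Fin m → Fin n} {ρ : Fin n → ℕ} {ρ' : Fin m → ℕ} →
            (∀ i → ρ (r i) ≡ ρ' i) → ∀ k i → ext k ρ (liftR r i) ≡ ext k ρ' i
ext-liftR h k fz     = refl
ext-liftR h k (fs i) = h i

ext-liftS : ∀ {m n} {σ : Fin m → Term n} {ρ : Fin n → ℕ} {ρ' : Fin m → ℕ} →
            (∀ i → ⟦ σ i ⟧ ρ ≡ ρ' i) → ∀ k i → ⟦ liftS σ i ⟧ (ext k ρ) ≡ ext k ρ' i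
ext-liftS         h k fz     = refl
ext-liftS {σ = σ} h k (fs i) = trans (⟦⟧-rename fs (λ _ → refl) (σ i)) (h i)

module _ (I : Interp) where

  -- Reading ∨ and ∃ negatively makes the multi-succedent calculus
  -- constructively sound.
  Sat¬¬ : ∀ {n} → (Fin n → ℕ) → Formula n → Set
  Sat¬¬ ρ (s ≐ t) = ⟦ s ⟧ ρ ≡ ⟦ t ⟧ ρ
  Sat¬¬ ρ (s ≉ t) = ⟦ s ⟧ ρ ≢ ⟦ t ⟧ ρ
  Sat¬¬ ρ (Tr t)  = T⁺ I (⟦ t ⟧ ρ)
  Sat¬¬ ρ (¬Tr t) = T⁻ I (⟦ t ⟧ ρ)
  Sat¬¬ ρ (Pd t)  = P⁺ I (⟦ t ⟧ ρ)
  Sat¬¬ ρ (¬Pd t) = P⁻ I (⟦ t ⟧ ρ)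
  Sat¬¬ ρ (φ ∧ ψ) = Sat¬¬ ρ φ × Sat¬¬ ρ ψ
  Sat¬¬ ρ (φ ∨ ψ) = ¬ (¬ Sat¬¬ ρ φ × ¬ Sat¬¬ ρ ψ)
  Sat¬¬ ρ (∀' φ)  = ∀ m → Sat¬¬ (ext m ρ) φ
  Sat¬¬ ρ (∃' φ)  = ¬ (∀ m → ¬ Sat¬¬ (ext m ρ) φ)

  Sat¬¬-rename : ∀ {m n} (r : Fin m → Fin n) {ρ : Fin n → ℕ} {ρ' : Fin m → ℕ} →
                 (∀ i → ρ (r i) ≡ ρ' i) → ∀ φ → Sat¬¬ ρ (frename r φ) ⇔ Sat¬¬ ρ' φ
  Sat¬¬-rename r h (s ≐ t) = ≡⇒⇔ (cong₂ _≡_ (⟦⟧-rename r h s) (⟦⟧-rename r h t))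
  Sat¬¬-rename r h (s ≉ t) = ≡⇒⇔ (cong₂ _≢_ (⟦⟧-rename r h s) (⟦⟧-rename r h t))
  Sat¬¬-rename r h (Tr t)  = ≡⇒⇔ (cong (T⁺ I) (⟦⟧-rename r h t))
  Sat¬¬-rename r h (¬Tr t) = ≡⇒⇔ (cong (T⁻ I) (⟦⟧-rename r h t))
  Sat¬¬-rename r h (Pd t)  = ≡⇒⇔ (cong (P⁺ I) (⟦⟧-rename r h t))
  Sat¬¬-rename r h (¬Pd t) = ≡⇒⇔ (cong (P⁻ I) (⟦⟧-rename r h t))
  Sat¬¬-rename r h (φ ∧ ψ) = Sat¬¬-rename r h φ ×-⇔ Sat¬¬-rename r h ψ
  Sat¬¬-rename r h (φ ∨ ψ) =
    ¬-cong-⇔ (¬-cong-⇔ (Sat¬¬-rename r h φ) ×-⇔ ¬-cong-⇔ (Sat¬¬-rename r h ψ))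
  Sat¬¬-rename r h (∀' φ) = ∀-cong-⇔ λ k → Sat¬¬-rename (liftR r) (ext-liftR h k) φ
  Sat¬¬-rename r h (∃' φ) =
    ¬-cong-⇔ (∀-cong-⇔ λ k → ¬-cong-⇔ (Sat¬¬-rename (liftR r) (ext-liftR h k) φ))

  Sat¬¬-subst : ∀ {m n} (σ : Fin m → Term n) {ρ : Fin n → ℕ} {ρ' : Fin m → ℕ} →
                (∀ i → ⟦ σ i ⟧ ρ ≡ ρ' i) → ∀ φ → Sat¬¬ ρ (fsubst σ φ) ⇔ Sat¬¬ ρ' φ
  Sat¬¬-subst σ h (s ≐ t) = ≡⇒⇔ (cong₂ _≡_ (⟦⟧-subst σ h s) (⟦⟧-subst σ h t))
  Sat¬¬-subst σ h (s ≉ t) = ≡⇒⇔ (cong₂ _≢_ (⟦⟧-subst σ h s) (⟦⟧-subst σ h t))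
  Sat¬¬-subst σ h (Tr t)  = ≡⇒⇔ (cong (T⁺ I) (⟦⟧-subst σ h t))
  Sat¬¬-subst σ h (¬Tr t) = ≡⇒⇔ (cong (T⁻ I) (⟦⟧-subst σ h t))
  Sat¬¬-subst σ h (Pd t)  = ≡⇒⇔ (cong (P⁺ I) (⟦⟧-subst σ h t))
  Sat¬¬-subst σ h (¬Pd t) = ≡⇒⇔ (cong (P⁻ I) (⟦⟧-subst σ h t))
  Sat¬¬-subst σ h (φ ∧ ψ) = Sat¬¬-subst σ h φ ×-⇔ Sat¬¬-subst σ h ψ
  Sat¬¬-subst σ h (φ ∨ ψ) =
    ¬-cong-⇔ (¬-cong-⇔ (Sat¬¬-subst σ h φ) ×-⇔ ¬-cong-⇔ (Sat¬¬-subst σ h ψ))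
  Sat¬¬-subst σ h (∀' φ) = ∀-cong-⇔ λ k → Sat¬¬-subst (liftS σ) (ext-liftS h k) φ
  Sat¬¬-subst σ h (∃' φ) =
    ¬-cong-⇔ (∀-cong-⇔ λ k → ¬-cong-⇔ (Sat¬¬-subst (liftS σ) (ext-liftS h k) φ))

  Sat¬¬-wk : ∀ {n} (ρ : Fin n → ℕ) k φ → Sat¬¬ (ext k ρ) (wk φ) ⇔ Sat¬¬ ρ φ
  Sat¬¬-wk ρ k = Sat¬¬-rename fs (λ _ → refl)

  Sat¬¬-inst : ∀ {n} (ρ : Fin n → ℕ) t φ → Sat¬¬ ρ (φ [ t ]) ⇔ Sat¬¬ (ext (⟦ t ⟧ ρ) ρ) φ
  Sat¬¬-inst ρ t = Sat¬¬-subst (inst t) λ { fz → refl ; (fs i) → refl }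

  Sat¬¬-S0 : ∀ {n} (ρ : Fin n → ℕ) k φ → Sat¬¬ (ext k ρ) (φ [S0]) ⇔ Sat¬¬ (ext (suc k) ρ) φ
  Sat¬¬-S0 ρ k = Sat¬¬-subst succVar λ { fz → refl ; (fs i) → refl }

  All-wk : ∀ {n} (ρ : Fin n → ℕ) k {Γ} →
           All (Sat¬¬ ρ) Γ → All (Sat¬¬ (ext k ρ)) (map wk Γ)
  All-wk ρ k = map⁺ ∘ All-map (λ {φ} → from (Sat¬¬-wk ρ k φ))

  All¬-wk : ∀ {n} (ρ : Fin n → ℕ) k {Δ} →
            All (¬_ ∘ Sat¬¬ ρ) Δ → All (¬_ ∘ Sat¬¬ (ext k ρ)) (map wk Δ)
  All¬-wk ρ k = map⁺ ∘ All-map (λ {φ} → _∘ to (Sat¬¬-wk ρ k φ))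

record StableConsistent (I : Interp) : Set where
  field
    T⁺-stable : ∀ n → Stable (T⁺ I n)
    T⁻-stable : ∀ n → Stable (T⁻ I n)
    P⁺-stable : ∀ n → Stable (P⁺ I n)
    P⁻-stable : ∀ n → Stable (P⁻ I n)
    T-consistent : ∀ n → T⁺ I n → ¬ T⁻ I n
    P-consistent : ∀ n → P⁺ I n → ¬ P⁻ I n

module Soundness {I : Interp} (sc : StableConsistent I) where
  open StableConsistent sc

  Sat¬¬-stable : ∀ {n} (ρ : Fin n → ℕ) φ → Stable (Sat¬¬ I ρ φ)
  Sat¬¬-stable ρ (s ≐ t) = decidable-stable (⟦ s ⟧ ρ ≟ ⟦ t ⟧ ρ)
  Sat¬¬-stable ρ (s ≉ t) ¬¬≢ e = ¬¬≢ (λ ≢ → ≢ e)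
  Sat¬¬-stable ρ (Tr t)  = T⁺-stable (⟦ t ⟧ ρ)
  Sat¬¬-stable ρ (¬Tr t) = T⁻-stable (⟦ t ⟧ ρ)
  Sat¬¬-stable ρ (Pd t)  = P⁺-stable (⟦ t ⟧ ρ)
  Sat¬¬-stable ρ (¬Pd t) = P⁻-stable (⟦ t ⟧ ρ)
  Sat¬¬-stable ρ (φ ∧ ψ) ¬¬φψ =
    Sat¬¬-stable ρ φ (λ ¬φ → ¬¬φψ (λ (a , _) → ¬φ a)) ,
    Sat¬¬-stable ρ ψ (λ ¬ψ → ¬¬φψ (λ (_ , b) → ¬ψ b))
  Sat¬¬-stable ρ (φ ∨ ψ) ¬¬φψ x = ¬¬φψ (λ f → f x)
  Sat¬¬-stable ρ (∀' φ) ¬¬∀ m = Sat¬¬-stable (ext m ρ) φ (λ ¬φ → ¬¬∀ (λ f → ¬φ (f m)))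
  Sat¬¬-stable ρ (∃' φ) ¬¬∃ x = ¬¬∃ (λ f → f x)

  Sat¬¬-consistent : ∀ {n} (ρ : Fin n → ℕ) φ → Sat¬¬ I ρ φ → ¬ Sat¬¬ I ρ (neg φ)
  Sat¬¬-consistent ρ (s ≐ t) e ≢ = ≢ e
  Sat¬¬-consistent ρ (s ≉ t) ≢ e = ≢ e
  Sat¬¬-consistent ρ (Tr t)  a b = T-consistent (⟦ t ⟧ ρ) a b
  Sat¬¬-consistent ρ (¬Tr t) a b = T-consistent (⟦ t ⟧ ρ) b a
  Sat¬¬-consistent ρ (Pd t)  a b = P-consistent (⟦ t ⟧ ρ) a b
  Sat¬¬-consistent ρ (¬Pd t) a b = P-consistent (⟦ t ⟧ ρ) b a
  Sat¬¬-consistent ρ (φ ∧ ψ) (a , b) ¬¬ =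
    ¬¬ (Sat¬¬-consistent ρ φ a , Sat¬¬-consistent ρ ψ b)
  Sat¬¬-consistent ρ (φ ∨ ψ) ¬¬ (a , b) =
    ¬¬ ((λ x → Sat¬¬-consistent ρ φ x a) , (λ x → Sat¬¬-consistent ρ ψ x b))
  Sat¬¬-consistent ρ (∀' φ) f ¬∀ = ¬∀ (λ m → Sat¬¬-consistent (ext m ρ) φ (f m))
  Sat¬¬-consistent ρ (∃' φ) ¬∀ f = ¬∀ (λ m a → Sat¬¬-consistent (ext m ρ) φ a (f m))

  sound : ∀ {n} {Γ Δ : List (Formula n)} → Γ ⇒ Δ → (ρ : Fin n → ℕ) →
          All (Sat¬¬ I ρ) Γ → ¬ All (¬_ ∘ Sat¬¬ I ρ) Δ
  sound (ax φ) ρ (a ∷ []) (¬a ∷ []) = ¬a a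
  sound (axK3 φ) ρ (a ∷ b ∷ []) _ = Sat¬¬-consistent ρ φ a b
  sound (struct Γ⊆ Δ⊆ d) ρ Γs ¬Δs = sound d ρ (anti-mono Γ⊆ Γs) (anti-mono Δ⊆ ¬Δs)
  sound (cut φ d e) ρ Γs ¬Δs = sound d ρ Γs ((λ a → sound e ρ (a ∷ Γs) ¬Δs) ∷ ¬Δs)
  sound (∧L d) ρ ((a , b) ∷ Γs) ¬Δs = sound d ρ (a ∷ b ∷ Γs) ¬Δs
  sound (∧R d e) ρ Γs (¬ab ∷ ¬Δs) =
    sound d ρ Γs ((λ a → sound e ρ Γs ((λ b → ¬ab (a , b)) ∷ ¬Δs)) ∷ ¬Δs)
  sound (∨L d e) ρ (¬¬ab ∷ Γs) ¬Δs =
    ¬¬ab ((λ a → sound d ρ (a ∷ Γs) ¬Δs) , (λ b → sound e ρ (b ∷ Γs) ¬Δs))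
  sound (∨R d) ρ Γs (¬ab ∷ ¬Δs) =
    ¬ab (λ (¬a , ¬b) → sound d ρ Γs (¬a ∷ ¬b ∷ ¬Δs))
  sound (∀L {φ = φ} t d) ρ (f ∷ Γs) ¬Δs =
    sound d ρ (from (Sat¬¬-inst I ρ t φ) (f (⟦ t ⟧ ρ)) ∷ Γs) ¬Δs
  sound (∀R {φ = φ} d) ρ Γs (¬∀ ∷ ¬Δs) =
    ¬∀ (λ m → Sat¬¬-stable (ext m ρ) φ (λ ¬φ →
      sound d (ext m ρ) (All-wk I ρ m Γs) (¬φ ∷ All¬-wk I ρ m ¬Δs)))
  sound (∃L d) ρ (¬∀¬ ∷ Γs) ¬Δs =
    ¬∀¬ (λ m a → sound d (ext m ρ) (a ∷ All-wk I ρ m Γs) (All¬-wk I ρ m ¬Δs))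
  sound (∃R {φ = φ} t d) ρ Γs (¬∃ ∷ ¬Δs) =
    sound d ρ Γs ((λ a → ¬∃ (λ ¬φ → ¬φ (⟦ t ⟧ ρ) (to (Sat¬¬-inst I ρ t φ) a))) ∷ ¬Δs)
  sound (eqRefl t) ρ [] (¬refl ∷ []) = ¬refl refl
  sound (eqSubst s t φ) ρ (s≡t ∷ a ∷ []) (¬b ∷ []) =
    ¬b (from (Sat¬¬-inst I ρ t φ)
          (subst (λ k → Sat¬¬ I (ext k ρ) φ) s≡t (to (Sat¬¬-inst I ρ s φ) a)))
  sound (eqDec s t) ρ [] (¬≡ ∷ ¬≢ ∷ []) = ¬≢ ¬≡
  sound (paSucc0 s) ρ [] (¬≢ ∷ []) = ¬≢ λ ()
  sound (paSuccInj s t) ρ (e ∷ []) (¬e ∷ []) = ¬e (suc-injective e)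
  sound (paAdd0 s) ρ [] (¬e ∷ []) = ¬e (+-identityʳ _)
  sound (paAddS s t) ρ [] (¬e ∷ []) = ¬e (+-suc (⟦ s ⟧ ρ) (⟦ t ⟧ ρ))
  sound (paMul0 s) ρ [] (¬e ∷ []) = ¬e (*-zeroʳ (⟦ s ⟧ ρ))
  sound (paMulS s t) ρ [] (¬e ∷ []) =
    ¬e (trans (*-suc (⟦ s ⟧ ρ) (⟦ t ⟧ ρ)) (+-comm (⟦ s ⟧ ρ) _))
  sound (ind φ t d) ρ (base ∷ Γs) (¬φt ∷ ¬Δs) =
    ¬φt (from (Sat¬¬-inst I ρ t φ) (holds-at (⟦ t ⟧ ρ)))
    where
      holds-at : ∀ k → Sat¬¬ I (ext k ρ) φ
      holds-at zero    = to (Sat¬¬-inst I ρ `0 φ) base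
      holds-at (suc k) = Sat¬¬-stable (ext (suc k) ρ) φ (λ ¬φ →
        sound d (ext k ρ) (holds-at k ∷ All-wk I ρ k Γs)
          (¬φ ∘ to (Sat¬¬-S0 I ρ k φ) ∷ All¬-wk I ρ k ¬Δs))

constP : Bool → Interp
T⁺ (constP b) _ = ⊥
T⁻ (constP b) _ = ⊥
P⁺ (constP b) _ = b ≡ true
P⁻ (constP b) _ = b ≡ false

constP-stableConsistent : ∀ b → StableConsistent (constP b)
constP-stableConsistent b = record
  { T⁺-stable    = λ _ ¬¬⊥ → ¬¬⊥ id
  ; T⁻-stable    = λ _ ¬¬⊥ → ¬¬⊥ id
  ; P⁺-stable    = λ _ → decidable-stable (b ≟ᵇ true)
  ; P⁻-stable    = λ _ → decidable-stable (b ≟ᵇ false)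
  ; T-consistent = λ _ ()
  ; P-consistent = λ { _ refl () }
  }

Pd∉B : ∀ t → ¬ InB (Pd t)
Pd∉B t ((Pd⇒¬T , _) , _) =
  Soundness.sound (constP-stableConsistent true) Pd⇒¬T noVars (refl ∷ []) ((λ ()) ∷ [])

¬Pd∉B : ∀ t → ¬ InB (¬Pd t)
¬Pd∉B t ((¬Pd⇒¬T , _) , _) =
  Soundness.sound (constP-stableConsistent false) ¬Pd⇒¬T noVars (refl ∷ []) ((λ ()) ∷ [])

pair-zero : ∀ b → pair 0 b ≡ suc (2 * b)
pair-zero b = +-identityʳ _

pair-suc : ∀ a b → pair (suc a) b ≡ 2 * pair a b
pair-suc a b = *-assoc 2 (2 ^ a) _

pair-injˡ : ∀ a b c d → pair a b ≡ pair c d → a ≡ c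
pair-injˡ zero    b zero    d _ = refl
pair-injˡ zero    b (suc c) d e =
  ⊥-elim (even≢odd (pair c d) b (trans (sym (pair-suc c d)) (trans (sym e) (pair-zero b))))
pair-injˡ (suc a) b zero    d e =
  ⊥-elim (even≢odd (pair a b) d (trans (sym (pair-suc a b)) (trans e (pair-zero d))))
pair-injˡ (suc a) b (suc c) d e =
  cong suc (pair-injˡ a b c d (*-cancelˡ-≡ _ _ 2 (trans (sym (pair-suc a b)) (trans e (pair-suc c d)))))

PLiteralCode : ℕ → Set
PLiteralCode n = Σ (Term 0) λ s → n ≡ # (Pd s) ⊎ n ≡ # (¬Pd s)

¬PLiteralCode-pair : ∀ k x → k ≢ 4 → k ≢ 5 → ¬ PLiteralCode (pair k x)
¬PLiteralCode-pair k x k≢4 _   (s , inj₁ e) = k≢4 (pair-injˡ k x 4 (tcode s) e)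
¬PLiteralCode-pair k x _   k≢5 (s , inj₂ e) = k≢5 (pair-injˡ k x 5 (tcode s) e)

𝒫sat⇒¬PLiteralCode : ∀ {I} φ → 𝒫sat I φ → ¬ PLiteralCode (# φ)
𝒫sat⇒¬PLiteralCode (Pd t)  (inj₁ Π) = ⊥-elim ([ Pd∉B t , ¬Pd∉B t ] Π)
𝒫sat⇒¬PLiteralCode (¬Pd t) (inj₁ Π) = ⊥-elim ([ ¬Pd∉B t , Pd∉B t ] Π)
𝒫sat⇒¬PLiteralCode (s ≐ t) _ = ¬PLiteralCode-pair 0 (pair (tcode s) (tcode t)) (λ ()) (λ ())
𝒫sat⇒¬PLiteralCode (s ≉ t) _ = ¬PLiteralCode-pair 1 (pair (tcode s) (tcode t)) (λ ()) (λ ())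
𝒫sat⇒¬PLiteralCode (Tr t)  _ = ¬PLiteralCode-pair 2 (tcode t) (λ ()) (λ ())
𝒫sat⇒¬PLiteralCode (¬Tr t) _ = ¬PLiteralCode-pair 3 (tcode t) (λ ()) (λ ())
𝒫sat⇒¬PLiteralCode (φ ∧ ψ) _ = ¬PLiteralCode-pair 6 (pair (# φ) (# ψ)) (λ ()) (λ ())
𝒫sat⇒¬PLiteralCode (φ ∨ ψ) _ = ¬PLiteralCode-pair 7 (pair (# φ) (# ψ)) (λ ()) (λ ())
𝒫sat⇒¬PLiteralCode (∀' φ) _  = ¬PLiteralCode-pair 8 (# φ) (λ ()) (λ ())
𝒫sat⇒¬PLiteralCode (∃' φ) _  = ¬PLiteralCode-pair 9 (# φ) (λ ()) (λ ())

noPLiterals : Interp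
T⁺ noPLiterals _ = ⊤
T⁻ noPLiterals _ = ⊤
P⁺ noPLiterals n = ¬ PLiteralCode n
P⁻ noPLiterals _ = ⊤

noPLiterals-closed : Closed noPLiterals
noPLiterals-closed = (λ _ _ → tt) , (λ _ _ → tt) , P⁺-closed , (λ _ _ → tt)
  where
    P⁺-closed : ∀ n → P⁺ (Γ𝒯𝒫 noPLiterals) n → P⁺ noPLiterals n
    P⁺-closed _ (φ , refl , 𝒫φ) = 𝒫sat⇒¬PLiteralCode φ 𝒫φ

mainTheorem11 : (t : Term 0) → ¬ P∞⁺ (# (Pd t)) × ¬ P∞⁺ (# (¬Pd t))
mainTheorem11 t = (λ Pt∈P∞ → Pt∈P∞ noPLiterals noPLiterals-closed (t , inj₁ refl))
                , (λ ¬Pt∈P∞ → ¬Pt∈P∞ noPLiterals noPLiterals-closed (t , inj₂ refl))
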